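{- Let $m\ge 4$ and let $1<c_2<c_3<\cdots<c_m$ be natural numbers. If the coin system $\langle 1,c_2,c_3\rangle$ is non-canonical, then the coin system $\$_2=\langle 1,c_2,c_3,\dots,c_m\rangle$ is non-canonical and there exists a counterexample $x$ of $\$_2$ with $x<c_m+c_3$.
   Context: A coin system is a tuple $\$=\langle c_1,\dots,c_m\rangle$ of natural numbers with $1=c_1<c_2<\cdots<c_m$. A representation of $x$ is a tuple $(\alpha_1,\dots,\alpha_m)$ of natural numbers with $\sum_i\alpha_ic_i=x$, of size $\sum_i\alpha_i$. The greedy representation $\mathrm{GRD}_{\$}(x)$ is the representation with $\sum_{j<i}\alpha_jc_j<c_i$ for all $2\le i\le m$; $\mathrm{OPT}_{\$}(x)$ is a representation of minimum size. The system is canonical if $|\mathrm{GRD}_{\$}(x)|=|\mathrm{OPT}_{\$}(x)|$ for all $x$, and non-canonical otherwise; a counterexample of $\$$ is a natural number $x$ with $|\mathrm{GRD}_{\$}(x)|>|\mathrm{OPT}_{\$}(x)|$. -}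

module Defs where

open import Data.Nat using (ℕ; zero; suc; _+_; _*_; _<_)
open import Data.Fin using (Fin; toℕ; inject≤)
open import Data.Product using (Σ; _×_; ∃-syntax)
open import Relation.Binary.PropositionalEquality using (_≡_)

sumFin : ∀ {n} → (Fin n → ℕ) → ℕ
sumFin {zero}  f = 0
sumFin {suc n} f = f Data.Fin.zero + sumFin (λ i → f (Data.Fin.suc i))

sumBelow : ∀ {n} → (Fin n → ℕ) → ℕ → ℕ
sumBelow {zero}  f k       = 0
sumBelow {suc n} f zero    = 0
sumBelow {suc n} f (suc k) = f Data.Fin.zero + sumBelow (λ i → f (Data.Fin.suc i)) k

-- A coin system with m coins, c 0 = c_1 = 1 and strictly increasing.
record IsCoinSystem {m : ℕ} (c : Fin m → ℕ) : Set where
  field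
    first-is-one : ∀ (i : Fin m) → toℕ i ≡ 0 → c i ≡ 1
    increasing   : ∀ (i j : Fin m) → toℕ i < toℕ j → c i < c j

Repr : ℕ → Set
Repr m = Fin m → ℕ

value : ∀ {m} → (Fin m → ℕ) → Repr m → ℕ
value c α = sumFin (λ i → α i * c i)

size : ∀ {m} → Repr m → ℕ
size α = sumFin α

IsRepr : ∀ {m} → (Fin m → ℕ) → ℕ → Repr m → Set
IsRepr c x α = value c α ≡ x

-- greedy condition: for every index i ≥ 1 (0-based; i.e. coin c_{i+1} with i+1 ≥ 2),
-- Σ_{j<i} α_j c_j < c_i
IsGreedy : ∀ {m} → (Fin m → ℕ) → Repr m → Set
IsGreedy c α = ∀ i → 0 < toℕ i → sumBelow (λ j → α j * c j) (toℕ i) < c i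

-- x is a counterexample: the greedy representation of x is strictly larger
-- than some representation of x (equivalently |GRD(x)| > |OPT(x)|).
Counterexample : ∀ {m} → (Fin m → ℕ) → ℕ → Set
Counterexample c x =
  ∃[ g ] ∃[ β ] (IsRepr c x g × IsGreedy c g × IsRepr c x β × size β < size g)

NonCanonical : ∀ {m} → (Fin m → ℕ) → Set
NonCanonical c = ∃[ x ] Counterexample c x

-- Let a = c₂ and b = c₃ = q a + r with r < a.  If r = 0 or a ≤ q + r, trading a coin b for
-- q coins a and r coins 1 (carrying into one more a when the ones reach a) never shortens a
-- representation, so ⟨1, a, b⟩ would be canonical; hence 0 < r and q < t := a − r.
--
-- Adding the coins c₄, …, c_m one at a time, we keep a counterexample x with x + 1 < L + b,
-- L the largest coin.  If x < L for the new coin L, x remains a counterexample.  Otherwise the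
-- previous largest coin P satisfies L + 1 < P + b, so z = P + b − L ≥ 2, and one of the
-- following is a counterexample below L + b whose greedy representation is L plus coins 1 and a:
--   a + P = (a − 1) + L     if L = P + 1,
--   q a + P = t + L         if z = a,
--   b + P = z + L           otherwise.
-- The case of ⟨1, a, b⟩ itself is the same construction with P = a and L = b.

module Submission where

open import Defs
open import Data.Nat
  using (ℕ; zero; suc; _+_; _*_; _∸_; _<_; _≤_; z≤n; s≤s; z<s; s<s; NonZero; >-nonZero; _/_; _%_; _≟_; _<?_)
open import Data.Nat.Properties
open import Data.Nat.DivMod using (m≡m%n+[m/n]*n; m%n<n; m≥n⇒m/n>0)
open import Data.Nat.Tactic.RingSolver using (solve; solve-∀)
open import Data.Fin using (Fin; zero; suc; toℕ; fromℕ; inject₁; _↑ˡ_)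
open import Data.Fin.Properties using (toℕ-inject₁; toℕ-fromℕ; toℕ≤pred[n]; toℕ-injective; toℕ-↑ˡ)
open import Data.Fin.Relation.Unary.Top using (view; ‵fromℕ; ‵inject₁)
open import Data.Vec.Functional using (init; last; tail)
open import Data.List using (_∷_; [])
open import Data.Product using (_×_; ∃-syntax; _,_)
open import Data.Sum using (inj₁; inj₂)
open import Data.Empty using (⊥-elim)
open import Function using (_∘_)
open import Relation.Binary.PropositionalEquality
open import Relation.Nullary using (Dec; yes; no)
open import Algebra.Properties.CommutativeMonoid.Sum +-0-commutativeMonoid
  using (sum; sum-cong-≗; ∑-distrib-+; sum-init-last)
open import Algebra.Properties.CommutativeSemigroup +-commutativeSemigroup using (x∙yz≈y∙xz; xy∙z≈y∙xz)

sumFin≡sum : ∀ {n} (f : Fin n → ℕ) → sumFin f ≡ sum f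
sumFin≡sum {zero}  f = refl
sumFin≡sum {suc n} f = cong (f zero +_) (sumFin≡sum (f ∘ suc))

sumFin-cong : ∀ {n} {f g : Fin n → ℕ} → f ≗ g → sumFin f ≡ sumFin g
sumFin-cong {f = f} {g} f≗g = begin
  sumFin f  ≡⟨ sumFin≡sum f ⟩
  sum f     ≡⟨ sum-cong-≗ f≗g ⟩
  sum g     ≡⟨ sumFin≡sum g ⟨
  sumFin g  ∎
  where open ≡-Reasoning

sumFin-+ : ∀ {n} (f g : Fin n → ℕ) → sumFin (λ i → f i + g i) ≡ sumFin f + sumFin g
sumFin-+ f g = begin
  sumFin (λ i → f i + g i)  ≡⟨ sumFin≡sum (λ i → f i + g i) ⟩
  sum (λ i → f i + g i)     ≡⟨ ∑-distrib-+ f g ⟩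
  sum f + sum g             ≡⟨ cong₂ _+_ (sumFin≡sum f) (sumFin≡sum g) ⟨
  sumFin f + sumFin g       ∎
  where open ≡-Reasoning

sumFin-init-last : ∀ {n} (f : Fin (suc n) → ℕ) → sumFin f ≡ sumFin (init f) + last f
sumFin-init-last f = begin
  sumFin f                ≡⟨ sumFin≡sum f ⟩
  sum f                   ≡⟨ sum-init-last f ⟩
  sum (init f) + last f   ≡⟨ cong (_+ last f) (sumFin≡sum (init f)) ⟨
  sumFin (init f) + last f ∎
  where open ≡-Reasoning

sumFin-zero : ∀ n → sumFin {n} (λ _ → 0) ≡ 0
sumFin-zero zero    = refl
sumFin-zero (suc n) = sumFin-zero n

sumBelow-cong : ∀ {n} {f g : Fin n → ℕ} → f ≗ g → ∀ B → sumBelow f B ≡ sumBelow g B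
sumBelow-cong {zero}  f≗g B       = refl
sumBelow-cong {suc n} f≗g zero    = refl
sumBelow-cong {suc n} f≗g (suc B) = cong₂ _+_ (f≗g zero) (sumBelow-cong (f≗g ∘ suc) B)

sumBelow-zero : ∀ n B → sumBelow {n} (λ _ → 0) B ≡ 0
sumBelow-zero zero    B       = refl
sumBelow-zero (suc n) zero    = refl
sumBelow-zero (suc n) (suc B) = sumBelow-zero n B

sumBelow-full : ∀ {n} (f : Fin n → ℕ) → sumBelow f n ≡ sumFin f
sumBelow-full {zero}  f = refl
sumBelow-full {suc n} f = cong (f zero +_) (sumBelow-full (f ∘ suc))

sumBelow-init : ∀ {n} (f : Fin (suc n) → ℕ) {B} → B ≤ n → sumBelow f B ≡ sumBelow (init f) B
sumBelow-init {zero}  f {zero}  _         = refl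
sumBelow-init {suc n} f {zero}  _         = refl
sumBelow-init {suc n} f {suc B} (s≤s B≤n) = cong (f zero +_) (sumBelow-init (f ∘ suc) B≤n)

infixl 6 _⊕_
_⊕_ : ∀ {m} → Repr m → Repr m → Repr m
(α ⊕ β) i = α i + β i

single : ∀ {m} → Fin m → ℕ → Repr m
single zero    k zero    = k
single zero    k (suc i) = 0
single (suc j) k zero    = 0
single (suc j) k (suc i) = single j k i

twoCoins : ∀ {n} → ℕ → ℕ → Repr (2 + n)
twoCoins u v zero          = u
twoCoins u v (suc zero)    = v
twoCoins u v (suc (suc i)) = 0

infixl 5 _∷ʳ_
_∷ʳ_ : ∀ {n} → Repr n → ℕ → Repr (suc n)
_∷ʳ_ {zero}  α k i       = k
_∷ʳ_ {suc n} α k zero    = α zero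
_∷ʳ_ {suc n} α k (suc i) = (tail α ∷ʳ k) i

init-∷ʳ : ∀ {n} (α : Repr n) k → init (α ∷ʳ k) ≗ α
init-∷ʳ {suc n} α k zero    = refl
init-∷ʳ {suc n} α k (suc i) = init-∷ʳ (tail α) k i

last-∷ʳ : ∀ {n} (α : Repr n) k → last (α ∷ʳ k) ≡ k
last-∷ʳ {zero}  α k = refl
last-∷ʳ {suc n} α k = last-∷ʳ (tail α) k

value-⊕ : ∀ {m} (c : Fin m → ℕ) α β → value c (α ⊕ β) ≡ value c α + value c β
value-⊕ c α β = trans (sumFin-cong (λ i → *-distribʳ-+ (c i) (α i) (β i)))
  (sumFin-+ (λ i → α i * c i) (λ i → β i * c i))

size-⊕ : ∀ {m} (α β : Repr m) → size (α ⊕ β) ≡ size α + size β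
size-⊕ = sumFin-+

value-single : ∀ {m} (c : Fin m → ℕ) j k → value c (single j k) ≡ k * c j
value-single {suc m} c zero k = trans (cong (k * c zero +_) (sumFin-zero m)) (+-identityʳ _)
value-single         c (suc j) k = value-single (c ∘ suc) j k

size-single : ∀ {m} (j : Fin m) k → size (single j k) ≡ k
size-single {suc m} zero k = trans (cong (k +_) (sumFin-zero m)) (+-identityʳ k)
size-single         (suc j) k = size-single j k

value-twoCoins : ∀ {n} (c : Fin (2 + n) → ℕ) u v → value c (twoCoins u v) ≡ u * c zero + v * c (suc zero)
value-twoCoins {n} c u v =
  cong (u * c zero +_) (trans (cong (v * c (suc zero) +_) (sumFin-zero n)) (+-identityʳ _))

size-twoCoins : ∀ {n} u v → size (twoCoins {n} u v) ≡ u + v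
size-twoCoins {n} u v = cong (u +_) (trans (cong (v +_) (sumFin-zero n)) (+-identityʳ v))

value-∷ʳ : ∀ {n} (c : Fin (suc n) → ℕ) (α : Repr n) k → value c (α ∷ʳ k) ≡ value (init c) α + k * last c
value-∷ʳ c α k = trans (sumFin-init-last (λ i → (α ∷ʳ k) i * c i))
  (cong₂ _+_ (sumFin-cong (λ i → cong (_* init c i) (init-∷ʳ α k i))) (cong (_* last c) (last-∷ʳ α k)))

size-∷ʳ : ∀ {n} (α : Repr n) k → size (α ∷ʳ k) ≡ size α + k
size-∷ʳ α k = trans (sumFin-init-last (α ∷ʳ k)) (cong₂ _+_ (sumFin-cong (init-∷ʳ α k)) (last-∷ʳ α k))

IsCoinSystem-∘ : ∀ {m n} {c : Fin n → ℕ} (f : Fin m → Fin n) → (∀ i → toℕ (f i) ≡ toℕ i) →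
  IsCoinSystem c → IsCoinSystem (c ∘ f)
IsCoinSystem-∘ f toℕ-f cs = record
  { first-is-one = λ i i≡0 → first-is-one (f i) (trans (toℕ-f i) i≡0)
  ; increasing   = λ i j i<j → increasing (f i) (f j) (subst₂ _<_ (sym (toℕ-f i)) (sym (toℕ-f j)) i<j)
  }
  where open IsCoinSystem cs

IsCoinSystem-init : ∀ {n} {c : Fin (suc n) → ℕ} → IsCoinSystem c → IsCoinSystem (init c)
IsCoinSystem-init = IsCoinSystem-∘ inject₁ toℕ-inject₁

*-first-coin : ∀ {m} {c : Fin (suc m) → ℕ} → IsCoinSystem c → ∀ u → u * c zero ≡ u
*-first-coin cs u = trans (cong (u *_) (IsCoinSystem.first-is-one cs zero refl)) (*-identityʳ u)

coin-mono : ∀ {m} {c : Fin m → ℕ} → IsCoinSystem c → ∀ {i j} → toℕ i ≤ toℕ j → c i ≤ c j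
coin-mono {c = c} cs {i} {j} i≤j with m≤n⇒m<n∨m≡n i≤j
... | inj₁ i<j = <⇒≤ (IsCoinSystem.increasing cs i j i<j)
... | inj₂ i≡j = ≤-reflexive (cong c (toℕ-injective i≡j))

1<coin₁ : ∀ {m} {c : Fin (2 + m) → ℕ} → IsCoinSystem c → 1 < c (suc zero)
1<coin₁ {c = c} cs = subst (_< c (suc zero)) (first-is-one zero refl) (increasing zero (suc zero) z<s)
  where open IsCoinSystem cs

coin₁<coin₂ : ∀ {m} {c : Fin (3 + m) → ℕ} → IsCoinSystem c → c (suc zero) < c (suc (suc zero))
coin₁<coin₂ cs = IsCoinSystem.increasing cs (suc zero) (suc (suc zero)) (s<s z<s)

last-init<last : ∀ {n} {c : Fin (suc (suc n)) → ℕ} → IsCoinSystem c → last (init c) < last c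
last-init<last {n} cs = IsCoinSystem.increasing cs _ _
  (subst₂ _<_ (sym (trans (toℕ-inject₁ (fromℕ n)) (toℕ-fromℕ n))) (sym (toℕ-fromℕ (suc n))) (n<1+n n))

twoCoins-greedy : ∀ {n} {c : Fin (2 + n) → ℕ} → IsCoinSystem c → ∀ {u v} → u < c (suc zero) →
  (∀ i → u + v * c (suc zero) < c (suc (suc i))) → IsGreedy c (twoCoins u v)
twoCoins-greedy {c = c} cs {u} u<a _ (suc zero) _ =
  subst (_< c (suc zero)) (sym (trans (+-identityʳ _) (*-first-coin cs u))) u<a
twoCoins-greedy {n} {c} cs {u} {v} _ below (suc (suc i)) _ =
  subst (_< c (suc (suc i))) (sym prefix≡) (below i)
  where
  prefix≡ : u * c zero + (v * c (suc zero) + sumBelow {n} (λ _ → 0) (toℕ i)) ≡ u + v * c (suc zero)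
  prefix≡ = cong₂ _+_ (*-first-coin cs u) (trans (cong (_ +_) (sumBelow-zero n (toℕ i))) (+-identityʳ _))

∷ʳ-greedy : ∀ {n} (c : Fin (suc n) → ℕ) {α : Repr n} {k} →
  IsGreedy (init c) α → value (init c) α < last c → IsGreedy c (α ∷ʳ k)
∷ʳ-greedy {n} c {α} {k} α-greedy α<last i 0<i = begin-strict
  sumBelow (λ j → (α ∷ʳ k) j * c j) (toℕ i)
    ≡⟨ sumBelow-init _ (toℕ≤pred[n] i) ⟩
  sumBelow (λ j → (α ∷ʳ k) (inject₁ j) * init c j) (toℕ i)
    ≡⟨ sumBelow-cong (λ j → cong (_* init c j) (init-∷ʳ α k j)) (toℕ i) ⟩
  sumBelow (λ j → α j * init c j) (toℕ i)
    <⟨ prefix<coin i 0<i ⟩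
  c i ∎
  where
  open ≤-Reasoning
  prefix<coin : ∀ i → 0 < toℕ i → sumBelow (λ j → α j * init c j) (toℕ i) < c i
  prefix<coin i 0<i with view i
  ... | ‵fromℕ = begin-strict
    sumBelow (λ j → α j * init c j) (toℕ (fromℕ n))  ≡⟨ cong (sumBelow (λ j → α j * init c j)) (toℕ-fromℕ n) ⟩
    sumBelow (λ j → α j * init c j) n               ≡⟨ sumBelow-full (λ j → α j * init c j) ⟩
    value (init c) α                                <⟨ α<last ⟩
    last c                                          ∎
  ... | ‵inject₁ j = subst (_< init c j) (cong (sumBelow (λ j → α j * init c j)) (sym (toℕ-inject₁ j)))
                       (α-greedy j (subst (0 <_) (toℕ-inject₁ j) 0<i))

counterexample-∷ʳ : ∀ {n} (c : Fin (suc n) → ℕ) {x} → Counterexample (init c) x → x < last c →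
  Counterexample c x
counterexample-∷ʳ c {x} (g , β , g↦x , g-greedy , β↦x , β<g) x<last =
  g ∷ʳ 0 , β ∷ʳ 0 , ∷ʳ0↦x g↦x ,
  ∷ʳ-greedy c g-greedy (subst (_< last c) (sym g↦x) x<last) ,
  ∷ʳ0↦x β↦x ,
  subst₂ _<_ (sym (size-∷ʳ β 0)) (sym (size-∷ʳ g 0)) (+-monoˡ-< 0 β<g)
  where
  ∷ʳ0↦x : ∀ {α} → IsRepr (init c) x α → IsRepr c x (α ∷ʳ 0)
  ∷ʳ0↦x {α} α↦x = trans (value-∷ʳ c α 0) (trans (+-identityʳ _) α↦x)

record Defect (a b : ℕ) : Set where
  field
    q r t  : ℕ
    b≡qa+r : b ≡ q * a + r
    a≡t+r  : a ≡ t + r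
    0<r    : 0 < r
    q<t    : q < t

defect-3≤a : ∀ {a b} → Defect a b → a < b → 3 ≤ a
defect-3≤a {a} {b} record { q = zero ; r = r ; t = t ; b≡qa+r = b≡r ; a≡t+r = a≡t+r } a<b =
  ⊥-elim (<⇒≱ a<b (begin
    b      ≡⟨ b≡r ⟩
    r      ≤⟨ m≤n+m r t ⟩
    t + r  ≡⟨ a≡t+r ⟨
    a      ∎))
  where open ≤-Reasoning
defect-3≤a record { q = suc q ; a≡t+r = a≡t+r ; 0<r = 0<r ; q<t = q<t } _ =
  subst (3 ≤_) (sym a≡t+r) (+-mono-≤ (≤-trans (s≤s (s≤s z≤n)) q<t) 0<r)

twoCoins-optimal : ∀ {a} g₀ g₁ β₀ β₁ → g₀ < a → β₀ + β₁ * a ≡ g₀ + g₁ * a → g₀ + g₁ ≤ β₀ + β₁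
twoCoins-optimal g₀ zero β₀ zero _ β≡g = ≤-reflexive (sym β≡g)
twoCoins-optimal {a} g₀ zero β₀ (suc β₁) g₀<a β≡g = ⊥-elim (<⇒≱ g₀<a (begin
  a                  ≤⟨ m≤m+n a (β₁ * a) ⟩
  a + β₁ * a         ≤⟨ m≤n+m _ β₀ ⟩
  β₀ + (a + β₁ * a)  ≡⟨ β≡g ⟩
  g₀ + 0             ≡⟨ +-identityʳ g₀ ⟩
  g₀                 ∎))
  where open ≤-Reasoning
twoCoins-optimal {a} g₀ (suc g₁) β₀ zero g₀<a β≡g = begin
  g₀ + suc g₁        ≤⟨ +-monoʳ-≤ g₀ (+-mono-≤ 0<a (m≤m*n g₁ a)) ⟩
  g₀ + (a + g₁ * a)  ≡⟨ β≡g ⟨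
  β₀ + 0             ∎
  where
  open ≤-Reasoning
  0<a = ≤-<-trans z≤n g₀<a
  instance _ = >-nonZero 0<a
twoCoins-optimal {a} g₀ (suc g₁) β₀ (suc β₁) g₀<a β≡g =
  subst₂ _≤_ (sym (+-suc g₀ g₁)) (sym (+-suc β₀ β₁))
    (s≤s (twoCoins-optimal g₀ g₁ β₀ β₁ g₀<a (+-cancelˡ-≡ a _ _ (begin
      a + (β₀ + β₁ * a)  ≡⟨ x∙yz≈y∙xz β₀ a _ ⟨
      β₀ + (a + β₁ * a)  ≡⟨ β≡g ⟩
      g₀ + (a + g₁ * a)  ≡⟨ x∙yz≈y∙xz g₀ a _ ⟩
      a + (g₀ + g₁ * a)  ∎))))
  where open ≡-Reasoning

module ThreeCoins {a b q r : ℕ} (b≡qa+r : b ≡ q * a + r) (r<a : r < a) (0<q : 0 < q)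
                  (criterion : 0 < r → a ≤ q + r) where

  exchange : ∀ j {g₀ g₁ β₀ β₁} → g₀ < a → β₀ + β₁ * a ≡ g₀ + g₁ * a + j * b → g₀ + g₁ + j ≤ β₀ + β₁
  exchange zero {g₀} {g₁} {β₀} {β₁} g₀<a β≡g =
    subst (_≤ β₀ + β₁) (sym (+-identityʳ _)) (twoCoins-optimal g₀ g₁ β₀ β₁ g₀<a (trans β≡g (+-identityʳ _)))
  exchange (suc j) {g₀} {g₁} {β₀} {β₁} g₀<a β≡g = carry (g₀ + r <? a)
    where
    replace-b : ∀ s e → s < a → g₀ + r ≡ s + e * a → g₀ < s + q + e → g₀ + g₁ + suc j ≤ β₀ + β₁
    replace-b s e s<a g₀+r≡s+ea grows = begin
      g₀ + g₁ + suc j       ≡⟨ solve (g₀ ∷ g₁ ∷ j ∷ []) ⟩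
      suc g₀ + (g₁ + j)     ≤⟨ +-monoˡ-≤ (g₁ + j) grows ⟩
      s + q + e + (g₁ + j)  ≡⟨ solve (s ∷ q ∷ e ∷ g₁ ∷ j ∷ []) ⟩
      s + (g₁ + q + e) + j  ≤⟨ exchange j {β₀ = β₀} {β₁} s<a β≡g′ ⟩
      β₀ + β₁               ∎
      where
      open ≤-Reasoning
      β≡g′ : β₀ + β₁ * a ≡ s + (g₁ + q + e) * a + j * b
      β≡g′ = begin-equality
        β₀ + β₁ * a                        ≡⟨ β≡g ⟩
        g₀ + g₁ * a + (b + j * b)          ≡⟨ cong (λ b′ → g₀ + g₁ * a + (b′ + j * b)) b≡qa+r ⟩
        g₀ + g₁ * a + (q * a + r + j * b)  ≡⟨ solve (g₀ ∷ g₁ ∷ a ∷ q ∷ r ∷ j ∷ b ∷ []) ⟩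
        g₀ + r + (g₁ + q) * a + j * b      ≡⟨ cong (λ y → y + (g₁ + q) * a + j * b) g₀+r≡s+ea ⟩
        s + e * a + (g₁ + q) * a + j * b   ≡⟨ solve (s ∷ e ∷ a ∷ g₁ ∷ q ∷ j ∷ b ∷ []) ⟩
        s + (g₁ + q + e) * a + j * b       ∎
    carry : Dec (g₀ + r < a) → g₀ + g₁ + suc j ≤ β₀ + β₁
    carry (yes g₀+r<a) = replace-b (g₀ + r) 0 g₀+r<a (sym (+-identityʳ _)) grows
      where
      grows : g₀ < g₀ + r + q + 0
      grows = <-≤-trans (m<m+n g₀ 0<q) (≤-trans (m≤m+n (g₀ + q) r) (≤-reflexive rearrange))
        where
        rearrange : g₀ + q + r ≡ g₀ + r + q + 0
        rearrange = solve (g₀ ∷ q ∷ r ∷ [])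
    carry (no g₀+r≮a) with m≤n⇒∃[o]m+o≡n (≮⇒≥ g₀+r≮a)
    ... | s , a+s≡g₀+r = replace-b s 1 s<a (trans (sym a+s≡g₀+r) (solve (a ∷ s ∷ [])))
      (≤-<-trans g₀≤s+q (m<m+n (s + q) z<s))
      where
      s<a : s < a
      s<a = +-cancelˡ-< a s a (subst (_< a + a) (sym a+s≡g₀+r) (+-mono-< g₀<a r<a))
      0<r : 0 < r
      0<r = +-cancelˡ-< g₀ 0 r (<-≤-trans (subst (_< a) (sym (+-identityʳ g₀)) g₀<a) (≮⇒≥ g₀+r≮a))
      g₀≤s+q : g₀ ≤ s + q
      g₀≤s+q = +-cancelʳ-≤ r g₀ (s + q) (begin
        g₀ + r       ≡⟨ a+s≡g₀+r ⟨
        a + s        ≤⟨ +-monoˡ-≤ s (criterion 0<r) ⟩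
        q + r + s    ≡⟨ solve (q ∷ r ∷ s ∷ []) ⟩
        s + q + r    ∎)
        where open ≤-Reasoning

  greedy-optimal : ∀ {g₀ g₁ g₂ β₀ β₁ β₂} → g₀ < a → g₀ + g₁ * a < b →
    β₀ + β₁ * a + β₂ * b ≡ g₀ + g₁ * a + g₂ * b → g₀ + g₁ + g₂ ≤ β₀ + β₁ + β₂
  greedy-optimal {g₀} {g₁} {g₂} {β₀} {β₁} {β₂} g₀<a g₀+g₁a<b β≡g
    with m≤n⇒∃[o]m+o≡n β₂≤g₂
    where
    β₂≤g₂ : β₂ ≤ g₂
    β₂≤g₂ = ≮⇒≥ λ g₂<β₂ → <⇒≱ (begin-strict
      g₀ + g₁ * a + g₂ * b  <⟨ +-monoˡ-< (g₂ * b) g₀+g₁a<b ⟩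
      b + g₂ * b            ≤⟨ *-monoˡ-≤ b g₂<β₂ ⟩
      β₂ * b                ≤⟨ m≤n+m (β₂ * b) (β₀ + β₁ * a) ⟩
      β₀ + β₁ * a + β₂ * b  ∎) (≤-reflexive β≡g)
      where open ≤-Reasoning
  ... | j , β₂+j≡g₂ = begin
    g₀ + g₁ + g₂          ≡⟨ cong (g₀ + g₁ +_) β₂+j≡g₂ ⟨
    g₀ + g₁ + (β₂ + j)    ≡⟨ solve (g₀ ∷ g₁ ∷ β₂ ∷ j ∷ []) ⟩
    g₀ + g₁ + j + β₂      ≤⟨ +-monoˡ-≤ β₂ (exchange j {β₀ = β₀} {β₁} g₀<a reduced) ⟩
    β₀ + β₁ + β₂          ∎
    where
    open ≤-Reasoning
    reduced : β₀ + β₁ * a ≡ g₀ + g₁ * a + j * b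
    reduced = +-cancelʳ-≡ (β₂ * b) _ _ (begin-equality
      β₀ + β₁ * a + β₂ * b          ≡⟨ β≡g ⟩
      g₀ + g₁ * a + g₂ * b          ≡⟨ cong (λ y → g₀ + g₁ * a + y * b) β₂+j≡g₂ ⟨
      g₀ + g₁ * a + (β₂ + j) * b    ≡⟨ solve (g₀ ∷ g₁ ∷ a ∷ β₂ ∷ j ∷ b ∷ []) ⟩
      g₀ + g₁ * a + j * b + β₂ * b  ∎)

nonCanonical₃⇒defect : ∀ {d : Fin 3 → ℕ} → IsCoinSystem d → NonCanonical d →
  Defect (d (suc zero)) (d (suc (suc zero)))
nonCanonical₃⇒defect {d} cs (_ , g , β , g↦x , g-greedy , β↦x , β<g) = decide (0 <? r) (q + r <? a)
  where
  open IsCoinSystem cs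
  a = d (suc zero)
  b = d (suc (suc zero))
  a<b : a < b
  a<b = coin₁<coin₂ cs
  instance
    a≢0 : NonZero a
    a≢0 = >-nonZero (<-trans z<s (1<coin₁ cs))
  q = b / a
  r = b % a
  b≡qa+r : b ≡ q * a + r
  b≡qa+r = trans (m≡m%n+[m/n]*n b a) (+-comm r (q * a))
  r<a : r < a
  r<a = m%n<n b a
  a∸r+r≡a : a ∸ r + r ≡ a
  a∸r+r≡a = m∸n+n≡m (<⇒≤ r<a)

  value₃ : ∀ α → value d α ≡ α zero + α (suc zero) * a + α (suc (suc zero)) * b
  value₃ α = trans (cong₂ _+_ (*-first-coin cs (α zero)) (cong (α (suc zero) * a +_) (+-identityʳ _)))
                   (sym (+-assoc (α zero) _ _))
  size₃ : ∀ α → size α ≡ α zero + α (suc zero) + α (suc (suc zero))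
  size₃ α = trans (cong (λ y → α zero + (α (suc zero) + y)) (+-identityʳ _)) (sym (+-assoc (α zero) _ _))

  greedy-size≤ : (0 < r → a ≤ q + r) → size g ≤ size β
  greedy-size≤ criterion = subst₂ _≤_ (sym (size₃ g)) (sym (size₃ β))
    (ThreeCoins.greedy-optimal b≡qa+r r<a (m≥n⇒m/n>0 (<⇒≤ a<b)) criterion
      {β₀ = β zero} {β (suc zero)} {β (suc (suc zero))} g₀<a g₀+g₁a<b β≡g)
    where
    g₀<a : g zero < a
    g₀<a = subst (_< a) (trans (+-identityʳ _) (*-first-coin cs (g zero))) (g-greedy (suc zero) z<s)
    g₀+g₁a<b : g zero + g (suc zero) * a < b
    g₀+g₁a<b = subst (_< b) (cong₂ _+_ (*-first-coin cs (g zero)) (+-identityʳ _))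
                 (g-greedy (suc (suc zero)) z<s)
    β≡g : β zero + β (suc zero) * a + β (suc (suc zero)) * b
        ≡ g zero + g (suc zero) * a + g (suc (suc zero)) * b
    β≡g = trans (sym (value₃ β)) (trans β↦x (trans (sym g↦x) (value₃ g)))

  decide : Dec (0 < r) → Dec (q + r < a) → Defect a b
  decide (yes 0<r) (yes q+r<a) = record
    { q = q ; r = r ; t = a ∸ r ; b≡qa+r = b≡qa+r ; a≡t+r = sym a∸r+r≡a ; 0<r = 0<r
    ; q<t = +-cancelʳ-< r q (a ∸ r) (subst (q + r <_) (sym a∸r+r≡a) q+r<a)
    }
  decide (no 0≮r) _          = ⊥-elim (<⇒≱ β<g (greedy-size≤ (λ 0<r → ⊥-elim (0≮r 0<r))))
  decide (yes _) (no q+r≮a) = ⊥-elim (<⇒≱ β<g (greedy-size≤ (λ _ → ≮⇒≥ q+r≮a)))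

1<u+v : ∀ {a} u v → 1 < u + v * a → u + v * a ≢ a → 1 < u + v
1<u+v u       zero          1<u _   = 1<u
1<u+v zero    (suc zero)    _   a≢a = ⊥-elim (a≢a (+-identityʳ _))
1<u+v (suc u) (suc zero)    _   _   = s≤s (m≤n+m 1 u)
1<u+v u       (suc (suc v)) _   _   = ≤-trans (s≤s (s≤s z≤n)) (m≤n+m (suc (suc v)) u)

module _ {n} {c : Fin (3 + n) → ℕ} (cs : IsCoinSystem c) where
  private
    a = c (suc zero)
    b = c (suc (suc zero))
    P = last (init c)
    L = last c
    a<b : a < b
    a<b = coin₁<coin₂ cs

  u+va+L-counterexample : ∀ u v j k → u < a → suc (u + v * a) < b → k * c j + P ≡ u + v * a + L →
    k < u + v → ∃[ x ] (Counterexample c x × suc x < L + b)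
  u+va+L-counterexample u v j k u<a 1+u+va<b β≡g k<u+v =
    u + v * a + L , (g , β , g↦x , g-greedy , β↦x , β<g) , 1+x<L+b
    where
    g : Repr (3 + n)
    g = twoCoins u v ∷ʳ 1
    prev : Fin (3 + n)
    prev = inject₁ (fromℕ (suc n))
    β : Repr (3 + n)
    β = single j k ⊕ single prev 1
    u+va<b : u + v * a < b
    u+va<b = <-trans (n<1+n _) 1+u+va<b
    prefix↦u+va : value (init c) (twoCoins u v) ≡ u + v * a
    prefix↦u+va = trans (value-twoCoins (init c) u v) (cong (_+ v * a) (*-first-coin cs u))
    g↦x : value c g ≡ u + v * a + L
    g↦x = trans (value-∷ʳ c (twoCoins u v) 1) (cong₂ _+_ prefix↦u+va (*-identityˡ L))
    g-greedy : IsGreedy c g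
    g-greedy = ∷ʳ-greedy c
      (twoCoins-greedy (IsCoinSystem-init cs) u<a (λ _ → <-≤-trans u+va<b (coin-mono cs (s≤s (s≤s z≤n)))))
      (subst (_< L) (sym prefix↦u+va)
        (<-≤-trans u+va<b (coin-mono cs (subst (2 ≤_) (sym (toℕ-fromℕ (2 + n))) (s≤s (s≤s z≤n))))))
    β↦x : value c β ≡ u + v * a + L
    β↦x = begin
      value c β                ≡⟨ value-⊕ c (single j k) (single prev 1) ⟩
      value c (single j k) + value c (single prev 1)
        ≡⟨ cong₂ _+_ (value-single c j k) (trans (value-single c prev 1) (*-identityˡ P)) ⟩
      k * c j + P              ≡⟨ β≡g ⟩
      u + v * a + L            ∎
      where open ≡-Reasoning
    β<g : size β < size g
    β<g = subst₂ _<_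
      (sym (trans (size-⊕ (single j k) (single prev 1)) (cong₂ _+_ (size-single j k) (size-single prev 1))))
      (sym (trans (size-∷ʳ (twoCoins {n} u v) 1) (cong (_+ 1) (size-twoCoins {n} u v))))
      (+-monoˡ-< 1 k<u+v)
    1+x<L+b : suc (u + v * a + L) < L + b
    1+x<L+b = subst (suc (u + v * a) + L <_) (+-comm b L) (+-monoˡ-< L 1+u+va<b)

  counterexample-near-last : Defect a b → suc L < P + b → ∃[ x ] (Counterexample c x × suc x < L + b)
  counterexample-near-last D 1+L<P+b with L ≟ suc P
  ... | yes L≡1+P with m≤n⇒∃[o]m+o≡n (defect-3≤a D a<b)
  ...   | w , 3+w≡a = u+va+L-counterexample (2 + w) 0 (suc zero) 1
    (≤-reflexive 3+w≡a)
    (subst (_< b) (sym (trans (cong suc (+-identityʳ _)) 3+w≡a)) a<b)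
    (begin
      1 * a + P             ≡⟨ cong (_+ P) (trans (*-identityˡ a) (sym 3+w≡a)) ⟩
      3 + w + P             ≡⟨ shift w P ⟩
      2 + w + 0 + suc P     ≡⟨ cong (2 + w + 0 +_) L≡1+P ⟨
      2 + w + 0 * a + L     ∎)
    (s≤s (s≤s z≤n))
    where
    open ≡-Reasoning
    shift : ∀ w p → 3 + w + p ≡ 2 + w + 0 + suc p
    shift = solve-∀
  counterexample-near-last D 1+L<P+b | no L≢1+P with m≤n⇒∃[o]m+o≡n (<⇒≤ (<-trans (n<1+n L) 1+L<P+b))
  ... | z , L+z≡P+b with z ≟ a
  ...   | yes z≡a = u+va+L-counterexample t 0 (suc zero) q t<a
    (≤-<-trans (subst (_< a) (sym (+-identityʳ t)) t<a) a<b)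
    (+-cancelʳ-≡ r _ _ (begin
      q * a + P + r         ≡⟨ xy∙z≈y∙xz (q * a) P r ⟩
      P + (q * a + r)       ≡⟨ cong (P +_) b≡qa+r ⟨
      P + b                 ≡⟨ L+z≡P+b ⟨
      L + z                 ≡⟨ cong (L +_) (trans z≡a a≡t+r) ⟩
      L + (t + r)           ≡⟨ rearrange L t r ⟩
      t + 0 * a + L + r     ∎))
    (subst (q <_) (sym (+-identityʳ t)) q<t)
    where
    open Defect D
    open ≡-Reasoning
    t<a : t < a
    t<a = subst (t <_) (sym a≡t+r) (m<m+n t 0<r)
    rearrange : ∀ l t r → l + (t + r) ≡ t + 0 + l + r
    rearrange = solve-∀
  ...   | no z≢a = u+va+L-counterexample (z % a) (z / a) (suc (suc zero)) 1 (m%n<n z a)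
    (subst (λ y → suc y < b) (sym z%a+z/a*a≡z) 2+z≤b)
    (begin-equality
      1 * b + P             ≡⟨ cong (_+ P) (*-identityˡ b) ⟩
      b + P                 ≡⟨ +-comm b P ⟩
      P + b                 ≡⟨ L+z≡P+b ⟨
      L + z                 ≡⟨ +-comm L z ⟩
      z + L                 ≡⟨ cong (_+ L) z%a+z/a*a≡z ⟨
      z % a + z / a * a + L ∎)
    (1<u+v (z % a) (z / a) (subst (1 <_) (sym z%a+z/a*a≡z) 2≤z) (z≢a ∘ trans (sym z%a+z/a*a≡z)))
    where
    open ≤-Reasoning
    instance
      a≢0 : NonZero a
      a≢0 = >-nonZero (<-trans z<s (1<coin₁ cs))
    z%a+z/a*a≡z : z % a + z / a * a ≡ z
    z%a+z/a*a≡z = sym (m≡m%n+[m/n]*n z a)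
    2≤z : 2 ≤ z
    2≤z = +-cancelˡ-≤ L 2 z (subst (_≤ L + z) (+-comm 2 L) (subst (2 + L ≤_) (sym L+z≡P+b) 1+L<P+b))
    2+z≤b : 2 + z ≤ b
    2+z≤b = +-cancelˡ-≤ P (2 + z) b (begin
      P + (2 + z)           ≡⟨ trans (+-suc P (suc z)) (cong suc (+-suc P z)) ⟩
      2 + P + z             ≤⟨ +-monoˡ-≤ z (≤∧≢⇒< (last-init<last cs) (L≢1+P ∘ sym)) ⟩
      L + z                 ≡⟨ L+z≡P+b ⟩
      P + b                 ∎)

counterexample-below : ∀ n (c : Fin (3 + n) → ℕ) → IsCoinSystem c →
  Defect (c (suc zero)) (c (suc (suc zero))) →
  ∃[ x ] (Counterexample c x × suc x < last c + c (suc (suc zero)))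
counterexample-below zero c cs D =
  counterexample-near-last cs D (+-monoˡ-< (c (suc (suc zero))) (1<coin₁ cs))
counterexample-below (suc n) c cs D with counterexample-below n (init c) (IsCoinSystem-init cs) D
... | x , x-counterexample , 1+x<P+b with x <? last c
...   | yes x<L = x , counterexample-∷ʳ c x-counterexample x<L ,
                  <-trans 1+x<P+b (+-monoˡ-< (c (suc (suc zero))) (last-init<last cs))
...   | no x≮L  = counterexample-near-last cs D (≤-<-trans (s≤s (≮⇒≥ x≮L)) 1+x<P+b)

theorem8 : (k : ℕ) (c : Fin (suc (suc (suc (suc k)))) → ℕ) → IsCoinSystem c →
    NonCanonical (λ (i : Fin 3) → c (i ↑ˡ suc k)) →
    NonCanonical c ×
      (∃[ x ] (Counterexample c x × x < c (fromℕ (suc (suc (suc k)))) + c (suc (suc zero))))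
theorem8 k c cs nc with counterexample-below (suc k) c cs (nonCanonical₃⇒defect prefix₃ nc)
  where
  prefix₃ : IsCoinSystem (λ (i : Fin 3) → c (i ↑ˡ suc k))
  prefix₃ = IsCoinSystem-∘ (_↑ˡ suc k) (λ i → toℕ-↑ˡ i (suc k)) cs
... | x , x-counterexample , 1+x<L+b =
  (x , x-counterexample) , (x , x-counterexample , <-trans (n<1+n x) 1+x<L+b)
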